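{- Let $n>0$ and let $i,j\ge 0$ be integers with $0\le i+j<n$. Then \[ K(n,i,j)=K(n,n-1-i-j,j). \]
   Context: A segmented permutation of size $n$ is a permutation $\sigma=\sigma_1\cdots\sigma_n$ of $\{1,\dots,n\}$, written as a word, together with a choice, for each position $i\in\{1,\dots,n-1\}$, of whether or not a bar is placed between $\sigma_i$ and $\sigma_{i+1}$. $SP_n$ denotes the set of segmented permutations of size $n$. A position $i<n$ is a segmentation if there is a bar between $\sigma_i$ and $\sigma_{i+1}$, and a descent if it is not a segmentation and $\sigma_i>\sigma_{i+1}$. $\operatorname{des}(\sigma)$ and $\operatorname{seg}(\sigma)$ denote the numbers of descents and of segmentations. $K(n,i,j)=\#\{\sigma\in SP_n\mid \operatorname{des}(\sigma)=i,\ \operatorname{seg}(\sigma)=j\}$. -}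

module Defs where

open import Data.Nat using (ℕ; zero; suc; _+_; _∸_; _<ᵇ_; _≤_; _<_; _≟_; _≤?_)
open import Data.Bool using (Bool; true; false; if_then_else_)
open import Data.List using (List; []; _∷_; map; concatMap; upTo; length; filter; cartesianProduct)
open import Data.List.Relation.Unary.All using (All)
open import Data.List.Relation.Unary.All as All using ()
open import Data.List.Relation.Unary.Unique.Propositional using (Unique)
open import Data.List.Relation.Unary.Unique.Propositional.Properties using ()
open import Data.Product using (_×_; _,_; proj₁; proj₂)
open import Relation.Nullary using (Dec; yes; no; _×-dec_)
open import Relation.Binary.PropositionalEquality using (_≡_)
import Data.List.Relation.Unary.Unique.DecPropositional as UDec

words : {A : Set} → List A → ℕ → List (List A)
words xs zero = [] ∷ []
words xs (suc k) = concatMap (λ x → map (x ∷_) (words xs k)) xs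

letters : ℕ → List ℕ
letters n = map suc (upTo n)

IsPerm : ℕ → List ℕ → Set
IsPerm n σ = (length σ ≡ n) × All (λ x → (1 ≤ x) × (x ≤ n)) σ × Unique σ

isPerm? : ∀ n σ → Dec (IsPerm n σ)
isPerm? n σ = (length σ ≟ n) ×-dec (All.all? (λ x → (1 ≤? x) ×-dec (x ≤? n)) σ ×-dec UDec.unique? _≟_ σ)

-- A segmented permutation of size n is a pair (σ , b) where σ is a permutation of
-- {1,…,n} written as a word and b = b₁⋯b_{n-1} is a list of booleans;
-- bᵢ = true means there is a bar between σᵢ and σᵢ₊₁.
SegPerm : Set
SegPerm = List ℕ × List Bool

SP : ℕ → List SegPerm
SP n = cartesianProduct (filter (isPerm? n) (words (letters n) n)) (words (true ∷ false ∷ []) (n ∸ 1))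

segCount : List Bool → ℕ
segCount [] = 0
segCount (true ∷ bs) = suc (segCount bs)
segCount (false ∷ bs) = segCount bs

desCount : List ℕ → List Bool → ℕ
desCount (x ∷ y ∷ σ) (b ∷ bs) =
  (if b then 0 else (if y <ᵇ x then 1 else 0)) + desCount (y ∷ σ) bs
desCount _ _ = 0

des : SegPerm → ℕ
des (σ , b) = desCount σ b

seg : SegPerm → ℕ
seg (σ , b) = segCount b

K : ℕ → ℕ → ℕ → ℕ
K n i j = length (filter (λ s → (des s ≟ i) ×-dec (seg s ≟ j)) (SP n))

module Submission where

-- The bijection is complementation of the underlying permutation,
-- σ = σ₁⋯σₙ ↦ σᶜ = (n+1-σ₁)⋯(n+1-σₙ), keeping the bars where they are.
-- Complementation reverses the order of any two distinct letters, so each of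
-- the n-1 positions of a segmented permutation is either a segmentation (in
-- both σ and σᶜ), or a descent of exactly one of σ and σᶜ.  Hence
--     des σ + des σᶜ + seg σ = n - 1,   seg σᶜ = seg σ,
-- and the involution σ ↦ σᶜ of SP_n exchanges the statistics (i , j) and
-- (n-1-i-j , j).

open import Defs
open import Data.Nat using (ℕ; _+_; _∸_; _<_)
open import Relation.Binary.PropositionalEquality using (_≡_)

open import Algebra.Properties.CommutativeSemigroup using (interchange; x∙yz≈y∙xz)
open import Data.Bool using (Bool; true; false; if_then_else_)
open import Data.List using (List; []; _∷_; _++_; map; concatMap; length; filter; cartesianProductWith)
open import Data.List.Membership.Propositional using (_∈_)
open import Data.List.Membership.Propositional.Properties
  using (∈-map⁺; ∈-map⁻; ∈-filter⁺; ∈-filter⁻; ∈-upTo⁺;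
         ∈-cartesianProductWith⁺; ∈-cartesianProductWith⁻;
         ∈-cartesianProduct⁺; ∈-cartesianProduct⁻)
open import Data.List.Membership.Propositional.Properties.WithK using (unique∧set⇒bag)
open import Data.List.Properties using (length-map; ∷-injective)
open import Data.List.Relation.Binary.BagAndSetEquality using (_∼[_]_; bag; ∼bag⇒↭)
open import Data.List.Relation.Binary.Permutation.Propositional.Properties using (↭-length)
open import Data.List.Relation.Unary.All using (All; []; _∷_)
import Data.List.Relation.Unary.All as All
import Data.List.Relation.Unary.All.Properties as All
open import Data.List.Relation.Unary.Any using (here; there)
open import Data.List.Relation.Unary.AllPairs using ([]; _∷_)
open import Data.List.Relation.Unary.Unique.Propositional using (Unique)
import Data.List.Relation.Unary.Unique.Propositional.Properties as Unique
open import Data.Nat using (zero; suc; _≤_; _<ᵇ_; _<?_; s≤s)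
open import Data.Nat.Properties
open import Data.Product using (_×_; _,_; proj₁; proj₂)
open import Function.Bundles using (mk⇔)
open import Level using (0ℓ)
open import Relation.Binary.Definitions using (tri<; tri≈; tri>)
open import Relation.Binary.PropositionalEquality using (refl; sym; trans; cong; cong₂; subst; module ≡-Reasoning)
open import Relation.Nullary using (¬_; yes; no; contradiction)
open import Relation.Nullary.Reflects using (Reflects; ofʸ; ofⁿ; fromEquivalence; det)
open import Relation.Unary using (Pred; Decidable)

open ≡-Reasoning

module _ {A : Set} where

  -- A map that is injective on the elements of a duplicate-free list keeps
  -- it duplicate-free (the library version asks for global injectivity).
  map⁺-injectiveOn : {B : Set} (f : A → B) (xs : List A) → Unique xs →
    (∀ {x y} → x ∈ xs → y ∈ xs → f x ≡ f y → x ≡ y) → Unique (map f xs)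
  map⁺-injectiveOn f [] [] inj = []
  map⁺-injectiveOn f (x ∷ xs) (x∉xs ∷ u) inj =
    All.map⁺ (All.tabulate λ y∈ fx≡fy → All.lookup x∉xs y∈ (inj (here refl) (there y∈) fx≡fy))
    ∷ map⁺-injectiveOn f xs u (λ x∈ y∈ → inj (there x∈) (there y∈))

  involution-count : {P Q : Pred A 0ℓ} (P? : Decidable P) (Q? : Decidable Q)
    (L : List A) → Unique L → (f : A → A) →
    (∀ {x} → x ∈ L → f x ∈ L) → (∀ {x} → x ∈ L → f (f x) ≡ x) →
    (∀ {x} → x ∈ L → P x → Q (f x)) → (∀ {x} → x ∈ L → Q x → P (f x)) →
    length (filter P? L) ≡ length (filter Q? L)
  involution-count P? Q? L uniq f closed invol P⇒Q Q⇒P = begin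
    length (filter P? L)           ≡⟨ length-map f (filter P? L) ⟨
    length (map f (filter P? L))   ≡⟨ ↭-length (∼bag⇒↭ same-bag) ⟩
    length (filter Q? L)           ∎
    where
    inL : ∀ {x} → x ∈ filter P? L → x ∈ L
    inL x∈ = proj₁ (∈-filter⁻ P? x∈)

    image-unique : Unique (map f (filter P? L))
    image-unique = map⁺-injectiveOn f _ (Unique.filter⁺ P? uniq) λ x∈ y∈ fx≡fy →
      trans (sym (invol (inL x∈))) (trans (cong f fx≡fy) (invol (inL y∈)))

    to : ∀ {v} → v ∈ map f (filter P? L) → v ∈ filter Q? L
    to v∈ with x , x∈ , refl ← ∈-map⁻ f v∈ with xL , px ← ∈-filter⁻ P? x∈ =
      ∈-filter⁺ Q? (closed xL) (P⇒Q xL px)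

    from : ∀ {v} → v ∈ filter Q? L → v ∈ map f (filter P? L)
    from v∈ with vL , qv ← ∈-filter⁻ Q? v∈ =
      subst (_∈ map f (filter P? L)) (invol vL)
        (∈-map⁺ f (∈-filter⁺ P? (closed vL) (Q⇒P vL qv)))

    same-bag : map f (filter P? L) ∼[ bag ] filter Q? L
    same-bag = unique∧set⇒bag image-unique (Unique.filter⁺ Q? uniq) (mk⇔ to from)

module _ {A : Set} where

  prepend-all : (ys : List A) (W : List (List A)) →
    concatMap (λ y → map (y ∷_) W) ys ≡ cartesianProductWith _∷_ ys W
  prepend-all [] W = refl
  prepend-all (y ∷ ys) W = cong (map (y ∷_) W ++_) (prepend-all ys W)

  words-suc : (xs : List A) (k : ℕ) → words xs (suc k) ≡ cartesianProductWith _∷_ xs (words xs k)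
  words-suc xs k = prepend-all xs (words xs k)

  ∈-words⁻ : {xs ws : List A} (k : ℕ) → ws ∈ words xs k → length ws ≡ k
  ∈-words⁻ zero (here refl) = refl
  ∈-words⁻ {xs} (suc k) ws∈
    with _ , _ , _ , vs∈ , refl ← ∈-cartesianProductWith⁻ _∷_ xs (words xs k) (subst (_ ∈_) (words-suc xs k) ws∈) =
    cong suc (∈-words⁻ k vs∈)

  ∈-words⁺ : {xs : List A} (ws : List A) → All (_∈ xs) ws → ws ∈ words xs (length ws)
  ∈-words⁺ [] [] = here refl
  ∈-words⁺ {xs} (w ∷ ws) (w∈ ∷ ws⊆) =
    subst (_ ∈_) (sym (words-suc xs (length ws))) (∈-cartesianProductWith⁺ _∷_ w∈ (∈-words⁺ ws ws⊆))

  words-unique : {xs : List A} → Unique xs → (k : ℕ) → Unique (words xs k)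
  words-unique u zero = [] ∷ []
  words-unique {xs} u (suc k) =
    subst Unique (sym (words-suc xs k)) (Unique.cartesianProductWith⁺ _∷_ ∷-injective u (words-unique u k))

InRange : ℕ → ℕ → Set
InRange n x = (1 ≤ x) × (x ≤ n)

∈-letters : ∀ {n x} → InRange n x → x ∈ letters n
∈-letters {x = suc y} (_ , y<n) = ∈-map⁺ suc (∈-upTo⁺ y<n)

complement : ℕ → ℕ → ℕ
complement n x = suc n ∸ x

complement-inRange : ∀ {n x} → InRange n x → InRange n (complement n x)
complement-inRange {n} {suc y} (_ , y<n) = m<n⇒0<n∸m y<n , m∸n≤m n y

complement-involutive : ∀ {n x} → x ≤ suc n → complement n (complement n x) ≡ x
complement-involutive = m∸[m∸n]≡n

complement-reverses-< : ∀ {n} x {y} → y ≤ suc n →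
  (complement n y <ᵇ complement n x) ≡ (x <ᵇ y)
complement-reverses-< {n} x {y} y≤1+n = det reflects-x<y (<ᵇ-reflects-< x y)
  where
  reversed : complement n y < complement n x → x < y
  reversed cy<cx with x <? y
  ... | yes x<y = x<y
  ... | no x≮y = contradiction (∸-monoʳ-≤ (suc n) (≮⇒≥ x≮y)) (<⇒≱ cy<cx)

  reflects-x<y : Reflects (x < y) (complement n y <ᵇ complement n x)
  reflects-x<y = fromEquivalence (λ t → reversed (<ᵇ⇒< _ _ t))
                                 (λ x<y → <⇒<ᵇ (∸-monoʳ-< x<y y≤1+n))

isPerm-complement : ∀ {n σ} → IsPerm n σ → IsPerm n (map (complement n) σ)
isPerm-complement {n} {σ} (length≡n , inRange , distinct) =
  trans (length-map (complement n) σ) length≡n ,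
  All.map⁺ (All.map complement-inRange inRange) ,
  map⁺-injectiveOn (complement n) σ distinct λ x∈ y∈ cx≡cy →
    trans (sym (involutive x∈)) (trans (cong (complement n) cx≡cy) (involutive y∈))
  where
  involutive : ∀ {x} → x ∈ σ → complement n (complement n x) ≡ x
  involutive x∈ = complement-involutive (m≤n⇒m≤1+n (proj₂ (All.lookup inRange x∈)))

⟦_⟧ : Bool → ℕ
⟦ b ⟧ = if b then 1 else 0

exactly-one-smaller : ∀ {x y} → ¬ x ≡ y → ⟦ y <ᵇ x ⟧ + ⟦ x <ᵇ y ⟧ ≡ 1
exactly-one-smaller {x} {y} x≢y with <-cmp x y
... | tri< x<y _ y≮x rewrite det (<ᵇ-reflects-< x y) (ofʸ x<y) | det (<ᵇ-reflects-< y x) (ofⁿ y≮x) = refl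
... | tri≈ _ x≡y _ = contradiction x≡y x≢y
... | tri> x≮y _ y<x rewrite det (<ᵇ-reflects-< x y) (ofⁿ x≮y) | det (<ᵇ-reflects-< y x) (ofʸ y<x) = refl

descent-in-one-of-complements : ∀ {n x y} → InRange n y → ¬ x ≡ y →
  ⟦ y <ᵇ x ⟧ + ⟦ complement n y <ᵇ complement n x ⟧ ≡ 1
descent-in-one-of-complements {n} {x} {y} (_ , y≤n) x≢y
  rewrite complement-reverses-< {n} x (m≤n⇒m≤1+n y≤n) = exactly-one-smaller x≢y

des+desᶜ+seg : ∀ n x σ bs → length bs ≡ length σ → All (InRange n) (x ∷ σ) → Unique (x ∷ σ) →
  desCount (x ∷ σ) bs + desCount (map (complement n) (x ∷ σ)) bs + segCount bs ≡ length σ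
des+desᶜ+seg n x [] [] _ _ _ = refl
des+desᶜ+seg n x (y ∷ σ) (true ∷ bs) len (_ ∷ inRange) (_ ∷ distinct) =
  trans (+-suc _ (segCount bs)) (cong suc (des+desᶜ+seg n y σ bs (suc-injective len) inRange distinct))
des+desᶜ+seg n x (y ∷ σ) (false ∷ bs) len (_ ∷ inRange@(y∈ ∷ _)) ((x≢y ∷ _) ∷ distinct) = begin
  (d + D) + (dᶜ + Dᶜ) + segCount bs  ≡⟨ cong (_+ segCount bs) (interchange +-commutativeSemigroup d D dᶜ Dᶜ) ⟩
  (d + dᶜ) + (D + Dᶜ) + segCount bs  ≡⟨ +-assoc (d + dᶜ) (D + Dᶜ) (segCount bs) ⟩
  (d + dᶜ) + (D + Dᶜ + segCount bs)  ≡⟨ cong₂ _+_ (descent-in-one-of-complements y∈ x≢y)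
                                                 (des+desᶜ+seg n y σ bs (suc-injective len) inRange distinct) ⟩
  suc (length σ)                     ∎
  where
  d  = ⟦ y <ᵇ x ⟧
  dᶜ = ⟦ complement n y <ᵇ complement n x ⟧
  D  = desCount (y ∷ σ) bs
  Dᶜ = desCount (map (complement n) (y ∷ σ)) bs

complementSP : ℕ → SegPerm → SegPerm
complementSP n (σ , b) = map (complement n) σ , b

Perms : ℕ → List (List ℕ)
Perms n = filter (isPerm? n) (words (letters n) n)

Bars : ℕ → List (List Bool)
Bars n = words (true ∷ false ∷ []) (n ∸ 1)

∈-SP⁻ : ∀ {n σ b} → (σ , b) ∈ SP n → IsPerm n σ × length b ≡ n ∸ 1
∈-SP⁻ {n} s∈ with σ∈ , b∈ ← ∈-cartesianProduct⁻ (Perms n) (Bars n) s∈ =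
  proj₂ (∈-filter⁻ (isPerm? n) {xs = words (letters n) n} σ∈) , ∈-words⁻ (n ∸ 1) b∈

SP-unique : ∀ n → Unique (SP n)
SP-unique n = Unique.cartesianProduct⁺
  (Unique.filter⁺ (isPerm? n) (words-unique (Unique.map⁺ suc-injective (Unique.upTo⁺ n)) n))
  (words-unique (((λ ()) ∷ []) ∷ [] ∷ []) (n ∸ 1))

complementSP-closed : ∀ n {s} → s ∈ SP n → complementSP n s ∈ SP n
complementSP-closed n {σ , b} s∈ with σ∈ , b∈ ← ∈-cartesianProduct⁻ (Perms n) (Bars n) s∈ =
  ∈-cartesianProduct⁺ (∈-filter⁺ (isPerm? n) σᶜ∈words σᶜ-perm) b∈
  where
  σᶜ-perm : IsPerm n (map (complement n) σ)
  σᶜ-perm = isPerm-complement (proj₂ (∈-filter⁻ (isPerm? n) {xs = words (letters n) n} σ∈))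

  σᶜ∈words : map (complement n) σ ∈ words (letters n) n
  σᶜ∈words with length≡n , inRange , _ ← σᶜ-perm =
    subst (λ k → map (complement n) σ ∈ words (letters n) k) length≡n
      (∈-words⁺ (map (complement n) σ) (All.map ∈-letters inRange))

complementSP-involutive : ∀ n {s} → s ∈ SP n → complementSP n (complementSP n s) ≡ s
complementSP-involutive n {σ , b} s∈ with (_ , inRange , _) , _ ← ∈-SP⁻ {n} s∈ =
  cong (_, b) (involutive σ inRange)
  where
  involutive : ∀ σ → All (InRange n) σ → map (complement n) (map (complement n) σ) ≡ σ
  involutive [] [] = refl
  involutive (x ∷ σ) ((_ , x≤n) ∷ inRange) =
    cong₂ _∷_ (complement-involutive (m≤n⇒m≤1+n x≤n)) (involutive σ inRange)

des+desᶜ+seg-SP : ∀ m {s} → s ∈ SP (suc m) → des s + des (complementSP (suc m) s) + seg s ≡ m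
des+desᶜ+seg-SP m {[] , b} s∈ with (() , _) , _ ← ∈-SP⁻ {suc m} s∈
des+desᶜ+seg-SP m {x ∷ σ , b} s∈ with (length≡ , inRange , distinct) , length-b ← ∈-SP⁻ {suc m} s∈ =
  trans (des+desᶜ+seg (suc m) x σ b (trans length-b (sym (suc-injective length≡))) inRange distinct)
        (suc-injective length≡)

complementary-value : ∀ {d dᶜ i j m} → d + dᶜ + j ≡ m → d ≡ i → dᶜ ≡ m ∸ i ∸ j
complementary-value {d} {dᶜ} {i} {j} {m} total refl = sym (begin
  m ∸ i ∸ j                ≡⟨ cong (λ k → k ∸ i ∸ j) (trans (sym total) (+-assoc i dᶜ j)) ⟩
  i + (dᶜ + j) ∸ i ∸ j     ≡⟨ cong (_∸ j) (m+n∸m≡n i (dᶜ + j)) ⟩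
  dᶜ + j ∸ j               ≡⟨ m+n∸n≡m dᶜ j ⟩
  dᶜ                       ∎)

complementary-value⁻ : ∀ {d dᶜ i j m} → d + dᶜ + j ≡ m → d ≡ m ∸ i ∸ j → i + j ≤ m → dᶜ ≡ i
complementary-value⁻ {d} {dᶜ} {i} {j} {m} total refl i+j≤m = +-cancelʳ-≡ (d + j) dᶜ i (begin
  dᶜ + (d + j)             ≡⟨ x∙yz≈y∙xz +-commutativeSemigroup dᶜ d j ⟩
  d + (dᶜ + j)             ≡⟨ +-assoc d dᶜ j ⟨
  d + dᶜ + j               ≡⟨ total ⟩
  m                        ≡⟨ m∸n+n≡m i+j≤m ⟨
  m ∸ (i + j) + (i + j)    ≡⟨ cong (_+ (i + j)) (∸-+-assoc m i j) ⟨
  d + (i + j)              ≡⟨ x∙yz≈y∙xz +-commutativeSemigroup d i j ⟩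
  i + (d + j)              ∎)

mainTheorem2 : (n i j : ℕ) → 0 < n → i + j < n → K n i j ≡ K n (n ∸ 1 ∸ i ∸ j) j
mainTheorem2 (suc m) i j _ (s≤s i+j≤m) =
  involution-count _ _ (SP n) (SP-unique n) (complementSP n)
    (complementSP-closed n) (complementSP-involutive n)
    (λ s∈ (des≡i , seg≡j) → complementary-value (statistics s∈ seg≡j) des≡i , seg≡j)
    (λ s∈ (desᶜ≡ , seg≡j) → complementary-value⁻ (statistics s∈ seg≡j) desᶜ≡ i+j≤m , seg≡j)
  where
  n = suc m

  statistics : ∀ {s} → s ∈ SP n → seg s ≡ j → des s + des (complementSP n s) + j ≡ m
  statistics {s} s∈ refl = des+desᶜ+seg-SP m s∈
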